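{- If $\mathsf X$ is a $\sigma$-algebra over a termlike $\sigma$-algebra $\mathsf U$, then $\mathrm{Pow}_{\text{amgis}}(\mathsf X)$ is an exact amgis-algebra over $\mathsf U$.
   Context: Atoms $\mathbb A$ (countably infinite; $a,b,c$ distinct), permutations, swappings $(a\ b)$, nominal sets, support, $a\#x$, equivariance as standard; $\mathsf N c.\Phi(c)$ means $\Phi(c)$ holds for all but finitely many atoms $c$. Termlike $\sigma$-algebra $\mathsf U$: nominal set with equivariant $x[a:=u]$ and equivariant injection $\mathrm{atm}:\mathbb A\to\mathsf U$ satisfying $a[a:=x]=x$; $x[a:=a]=x$; $a\#x\Rightarrow x[a:=u]=x$; $b\#x\Rightarrow x[a:=u]=((b\ a)\cdot x)[b:=u]$; $a\#v\Rightarrow x[a:=u][b:=v]=x[b:=v][a:=u[b:=v]]$. A $\sigma$-algebra over $\mathsf U$: nominal set $\mathsf X$ with equivariant substitution $x[a:=u]$ ($u\in\mathsf U$) satisfying the last four axioms. Amgis-algebra over $\mathsf U$: a set with permutation action $\mathsf P$ and equivariant $p[u\Leftarrow a]$ with $a\#v\Rightarrow p[v\Leftarrow b][u\Leftarrow a]=p[u[b:=v]\Leftarrow a][v\Leftarrow b]$. Exact: for all $p,q\in\mathsf P$, $u\in\mathsf U$, $\mathsf N c.\,p[u\Leftarrow c]=q[u\Leftarrow c]$ implies $p=q$. $\mathrm{Pow}_{\text{amgis}}(\mathsf X)$: all subsets $p\subseteq|\mathsf X|$, with $\pi\cdot p$ pointwise and $p[u\Leftarrow a]=\{x\mid x[a:=u]\in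 p\}$. -}

module Defs where

open import Level using (Level; _⊔_; suc; 0ℓ)
open import Data.Nat using (ℕ; _≟_)
open import Data.List using (List; []; _∷_; _++_)
open import Data.List.Membership.Propositional using (_∈_; _∉_)
open import Data.List.Membership.Propositional.Properties using (∈-++⁺ˡ; ∈-++⁺ʳ)
open import Data.List.Relation.Unary.Any using (here; there)
open import Data.Product using (Σ; ∃; _×_; _,_)
open import Relation.Nullary using (¬_; yes; no)
open import Relation.Binary using (IsEquivalence)
open import Relation.Binary.PropositionalEquality
  using (_≡_; _≢_; refl; sym; trans; cong)

-- Atoms: a countably infinite set with decidable equality

Atom : Set
Atom = ℕ

record Perm : Set where
  field
    to      : Atom → Atom
    from    : Atom → Atom
    to-from : ∀ a → to (from a) ≡ a
    from-to : ∀ a → from (to a) ≡ a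
    dom     : List Atom
    fixed   : ∀ a → a ∉ dom → to a ≡ a

open Perm public using (to)

idPerm : Perm
idPerm = record
  { to = λ a → a ; from = λ a → a
  ; to-from = λ _ → refl ; from-to = λ _ → refl
  ; dom = [] ; fixed = λ _ _ → refl }

_∘ₚ_ : Perm → Perm → Perm
π ∘ₚ τ = record
  { to = λ a → Perm.to π (Perm.to τ a)
  ; from = λ a → Perm.from τ (Perm.from π a)
  ; to-from = λ a → trans (cong (Perm.to π) (Perm.to-from τ (Perm.from π a))) (Perm.to-from π a)
  ; from-to = λ a → trans (cong (Perm.from τ) (Perm.from-to π (Perm.to τ a))) (Perm.from-to τ a)
  ; dom = Perm.dom π ++ Perm.dom τ
  ; fixed = λ a a∉ →
      trans (cong (Perm.to π) (Perm.fixed τ a (λ a∈ → a∉ (∈-++⁺ʳ (Perm.dom π) a∈))))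
            (Perm.fixed π a (λ a∈ → a∉ (∈-++⁺ˡ a∈)))
  }

invPerm : Perm → Perm
invPerm π = record
  { to = Perm.from π ; from = Perm.to π
  ; to-from = Perm.from-to π ; from-to = Perm.to-from π
  ; dom = Perm.dom π
  ; fixed = λ a a∉ → trans (cong (Perm.from π) (sym (Perm.fixed π a a∉))) (Perm.from-to π a)
  }

swapAt : Atom → Atom → Atom → Atom
swapAt a b c with c ≟ a
... | yes _ = b
... | no _ with c ≟ b
...   | yes _ = a
...   | no _ = c

swapAt-invol : ∀ a b c → swapAt a b (swapAt a b c) ≡ c
swapAt-invol a b c with c ≟ a
swapAt-invol a b c | yes c≡a with b ≟ a
... | yes b≡a = trans b≡a (sym c≡a)
... | no _ with b ≟ b
...   | yes _ = sym c≡a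
...   | no b≢b with () ← b≢b refl
swapAt-invol a b c | no c≢a with c ≟ b
swapAt-invol a b c | no c≢a | yes c≡b with a ≟ a
... | yes _ = sym c≡b
... | no a≢a with () ← a≢a refl
swapAt-invol a b c | no c≢a | no c≢b with c ≟ a
... | yes c≡a with () ← c≢a c≡a
... | no _ with c ≟ b
...   | yes c≡b with () ← c≢b c≡b
...   | no _ = refl

swapAt-fixed : ∀ a b c → c ∉ (a ∷ b ∷ []) → swapAt a b c ≡ c
swapAt-fixed a b c c∉ with c ≟ a
... | yes c≡a with () ← c∉ (here c≡a)
... | no _ with c ≟ b
...   | yes c≡b with () ← c∉ (there (here c≡b))
...   | no _ = refl

swap : Atom → Atom → Perm
swap a b = record
  { to = swapAt a b ; from = swapAt a b
  ; to-from = swapAt-invol a b ; from-to = swapAt-invol a b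
  ; dom = a ∷ b ∷ [] ; fixed = swapAt-fixed a b }

-- "for all but finitely many atoms":  N c. Φ(c)

𝖭 : ∀ {ℓ} → (Atom → Set ℓ) → Set ℓ
𝖭 Φ = ∃ λ (L : List Atom) → ∀ c → c ∉ L → Φ c

record IsPermAction {c ℓ : Level} {C : Set c}
                    (_≈_ : C → C → Set ℓ) (_·_ : Perm → C → C) : Set (c ⊔ ℓ) where
  field
    isEquivalence : IsEquivalence _≈_
    ·-cong : ∀ π {x y} → x ≈ y → (π · x) ≈ (π · y)
    -- permutations are functions: extensionally equal ones act equally
    ·-ext  : ∀ π τ → (∀ a → to π a ≡ to τ a) → ∀ x → (π · x) ≈ (τ · x)
    ·-id   : ∀ x → (idPerm · x) ≈ x
    ·-comp : ∀ π τ x → (π · (τ · x)) ≈ ((π ∘ₚ τ) · x)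

record Nominal : Set₁ where
  field
    Carrier : Set
    _·_     : Perm → Carrier → Carrier
    ·-ext   : ∀ π τ → (∀ a → to π a ≡ to τ a) → ∀ x → π · x ≡ τ · x
    ·-id    : ∀ x → idPerm · x ≡ x
    ·-comp  : ∀ π τ x → π · (τ · x) ≡ (π ∘ₚ τ) · x

  Supports : List Atom → Carrier → Set
  Supports A x = ∀ π → (∀ a → a ∈ A → to π a ≡ a) → π · x ≡ x

  field
    finitelySupported : ∀ x → ∃ λ (A : List Atom) → Supports A x

  -- freshness: a # x  iff  a is not in the (least) support of x, i.e.
  -- some finite support of x avoids a
  _#_ : Atom → Carrier → Set
  a # x = ∃ λ (A : List Atom) → Supports A x × a ∉ A

record TermlikeSigma : Set₁ where
  field
    nom : Nominal
  open Nominal nom public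
  field
    _[_≔_]   : Carrier → Atom → Carrier → Carrier
    subst-equivariant : ∀ π x a u → π · (x [ a ≔ u ]) ≡ (π · x) [ to π a ≔ π · u ]
    atm      : Atom → Carrier
    atm-equivariant : ∀ π a → π · atm a ≡ atm (to π a)
    atm-injective   : ∀ {a b} → atm a ≡ atm b → a ≡ b
    σ-var : ∀ a x → atm a [ a ≔ x ] ≡ x
    σ-id  : ∀ a x → x [ a ≔ atm a ] ≡ x
    σ-#   : ∀ a x u → a # x → x [ a ≔ u ] ≡ x
    σ-α   : ∀ a b x u → a ≢ b → b # x → x [ a ≔ u ] ≡ (swap b a · x) [ b ≔ u ]
    σ-σ   : ∀ a b x u v → a ≢ b → a # v →
            (x [ a ≔ u ]) [ b ≔ v ] ≡ (x [ b ≔ v ]) [ a ≔ u [ b ≔ v ] ]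

record SigmaAlg (U : TermlikeSigma) : Set₁ where
  module U = TermlikeSigma U
  field
    nom : Nominal
  open Nominal nom public
  field
    _[_≔_]   : Carrier → Atom → U.Carrier → Carrier
    subst-equivariant : ∀ π x a u → π · (x [ a ≔ u ]) ≡ (π · x) [ to π a ≔ π U.· u ]
    σ-id  : ∀ a x → x [ a ≔ U.atm a ] ≡ x
    σ-#   : ∀ a x u → a # x → x [ a ≔ u ] ≡ x
    σ-α   : ∀ a b x u → a ≢ b → b # x → x [ a ≔ u ] ≡ (swap b a · x) [ b ≔ u ]
    σ-σ   : ∀ a b x u v → a ≢ b → a U.# v →
            (x [ a ≔ u ]) [ b ≔ v ] ≡ (x [ b ≔ v ]) [ a ≔ u U.[ b ≔ v ] ]

record IsAmgisAlg (U : TermlikeSigma) {c ℓ : Level} {P : Set c}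
                  (_≈_ : P → P → Set ℓ) (_·_ : Perm → P → P)
                  (_[_⇐_] : P → TermlikeSigma.Carrier U → Atom → P) : Set (c ⊔ ℓ) where
  module U = TermlikeSigma U
  field
    isPermAction : IsPermAction _≈_ _·_
    ⇐-cong : ∀ {p q} u a → p ≈ q → (p [ u ⇐ a ]) ≈ (q [ u ⇐ a ])
    ⇐-equivariant : ∀ π p u a → (π · (p [ u ⇐ a ])) ≈ ((π · p) [ π U.· u ⇐ to π a ])
    amgis : ∀ p u v a b → a ≢ b → a U.# v →
            ((p [ v ⇐ b ]) [ u ⇐ a ]) ≈ ((p [ u U.[ b ≔ v ] ⇐ a ]) [ v ⇐ b ])

IsExact : (U : TermlikeSigma) {c ℓ : Level} {P : Set c}
          (_≈_ : P → P → Set ℓ)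
          (_[_⇐_] : P → TermlikeSigma.Carrier U → Atom → P) → Set (c ⊔ ℓ)
IsExact U {P = P} _≈_ _[_⇐_] =
  ∀ (p q : P) (u : TermlikeSigma.Carrier U) →
    𝖭 (λ c → (p [ u ⇐ c ]) ≈ (q [ u ⇐ c ])) → p ≈ q

-- Pow_amgis(X): all subsets of |X| (as predicates), equal when they have
-- the same elements; π·p pointwise; p[u⇐a] = {x | x[a:=u] ∈ p}.

module _ {U : TermlikeSigma} (X : SigmaAlg U) where
  private module X = SigmaAlg X

  PowCarrier : Set₁
  PowCarrier = X.Carrier → Set

  _≈Pow_ : PowCarrier → PowCarrier → Set
  p ≈Pow q = ∀ x → (p x → q x) × (q x → p x)

  -- π·p = {π·x | x ∈ p} = {y | π⁻¹·y ∈ p}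
  _·Pow_ : Perm → PowCarrier → PowCarrier
  (π ·Pow p) y = p (invPerm π X.· y)

  _[_⇐Pow_] : PowCarrier → TermlikeSigma.Carrier U → Atom → PowCarrier
  (p [ u ⇐Pow a ]) x = p (x X.[ a ≔ u ])

module Submission where

-- Subsets are predicates on |X|, equal when
-- they have the same elements, so every law reduces to an equation in X:
--   * the permutation-action laws follow from those of X (read through π⁻¹);
--   * equivariance of p[u⇐a] is equivariance of substitution in X, after
--     cancelling π⁻¹·(π·u) = u in U;
--   * the amgis axiom is the σ-σ axiom of X read backwards through preimages;
--   * exactness: given x, pick an atom c fresh for x and outside the cofinite
--     exception set; then x[c:=u] = x by σ-#, so x ∈ p ⇔ x[c:=u] ∈ p
--     ⇔ x[c:=u] ∈ q ⇔ x ∈ q.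

open import Defs
open import Data.Product using (_×_; _,_; proj₁; proj₂; ∃)
open import Data.Nat using (suc; _≤_)
open import Data.Nat.Properties using (≤-trans; m≤m+n; m≤n+m; n≮n)
open import Data.Nat.ListAction using (sum)
open import Data.List using (List; _∷_; _++_)
open import Data.List.Membership.Propositional using (_∈_; _∉_)
open import Data.List.Membership.Propositional.Properties using (∈-++⁺ˡ; ∈-++⁺ʳ)
open import Data.List.Relation.Unary.Any using (here; there)
open import Relation.Binary using (IsEquivalence)
open import Relation.Binary.PropositionalEquality
  using (_≡_; refl; sym; trans; cong; cong₂; subst; module ≡-Reasoning)

∈⇒≤sum : ∀ {c} (L : List Atom) → c ∈ L → c ≤ sum L
∈⇒≤sum (x ∷ L) (here refl) = m≤m+n x (sum L)
∈⇒≤sum (x ∷ L) (there c∈L) = ≤-trans (∈⇒≤sum L c∈L) (m≤n+m (sum L) x)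

fresh : (L : List Atom) → ∃ λ c → c ∉ L
fresh L = suc (sum L) , λ c∈L → n≮n (sum L) (∈⇒≤sum L c∈L)

from-ext : ∀ π τ → (∀ a → to π a ≡ to τ a) → ∀ a → Perm.from π a ≡ Perm.from τ a
from-ext π τ π≗τ a = begin
  Perm.from π a                          ≡⟨ sym (Perm.from-to τ _) ⟩
  Perm.from τ (to τ (Perm.from π a))     ≡⟨ cong (Perm.from τ) (sym (π≗τ _)) ⟩
  Perm.from τ (to π (Perm.from π a))     ≡⟨ cong (Perm.from τ) (Perm.to-from π a) ⟩
  Perm.from τ a                          ∎
  where open ≡-Reasoning

inv-cancel : (N : Nominal) → let open Nominal N in ∀ π x → invPerm π · (π · x) ≡ x
inv-cancel N π x = begin
  invPerm π · (π · x)     ≡⟨ ·-comp (invPerm π) π x ⟩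
  (invPerm π ∘ₚ π) · x    ≡⟨ ·-ext _ idPerm (Perm.from-to π) x ⟩
  idPerm · x              ≡⟨ ·-id x ⟩
  x                       ∎
  where open Nominal N; open ≡-Reasoning

module _ {U : TermlikeSigma} (X : SigmaAlg U) where
  private
    module U = TermlikeSigma U
    module X = SigmaAlg X

  ≡⇒∈⇔ : ∀ (p : PowCarrier X) {x y} → x ≡ y → (p x → p y) × (p y → p x)
  ≡⇒∈⇔ p x≡y = subst p x≡y , subst p (sym x≡y)

  ≈Pow-isEquivalence : IsEquivalence (_≈Pow_ X)
  ≈Pow-isEquivalence = record
    { refl  = λ x → (λ x∈p → x∈p) , (λ x∈p → x∈p)
    ; sym   = λ p≈q x → proj₂ (p≈q x) , proj₁ (p≈q x)
    ; trans = λ p≈q q≈r x → (λ x∈p → proj₁ (q≈r x) (proj₁ (p≈q x) x∈p))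
                          , (λ x∈r → proj₂ (p≈q x) (proj₂ (q≈r x) x∈r))
    }

  pow-isPermAction : IsPermAction (_≈Pow_ X) (_·Pow_ X)
  pow-isPermAction = record
    { isEquivalence = ≈Pow-isEquivalence
    ; ·-cong = λ π p≈q y → p≈q (invPerm π X.· y)
    ; ·-ext  = λ π τ π≗τ p y →
        ≡⇒∈⇔ p (X.·-ext (invPerm π) (invPerm τ) (from-ext π τ π≗τ) y)
    ; ·-id   = λ p y →
        ≡⇒∈⇔ p (trans (X.·-ext (invPerm idPerm) idPerm (λ _ → refl) y) (X.·-id y))
    ; ·-comp = λ π τ p y →
        ≡⇒∈⇔ p (trans (X.·-comp (invPerm τ) (invPerm π) y) (X.·-ext _ _ (λ _ → refl) y))
    }

  -- Equivariance of substitution in X, transported along π⁻¹: this is the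
  -- pointwise content of π·(p[u⇐a]) = (π·p)[π·u ⇐ π a].
  subst-under-inverse : ∀ π u a y →
    (invPerm π X.· y) X.[ a ≔ u ] ≡ invPerm π X.· (y X.[ to π a ≔ π U.· u ])
  subst-under-inverse π u a y = sym (begin
    invPerm π X.· (y X.[ to π a ≔ π U.· u ])
      ≡⟨ X.subst-equivariant (invPerm π) y (to π a) (π U.· u) ⟩
    (invPerm π X.· y) X.[ Perm.from π (to π a) ≔ invPerm π U.· (π U.· u) ]
      ≡⟨ cong₂ (λ b w → (invPerm π X.· y) X.[ b ≔ w ])
               (Perm.from-to π a) (inv-cancel U.nom π u) ⟩
    (invPerm π X.· y) X.[ a ≔ u ] ∎)
    where open ≡-Reasoning

  pow-isAmgisAlg : IsAmgisAlg U (_≈Pow_ X) (_·Pow_ X) (_[_⇐Pow_] X)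
  pow-isAmgisAlg = record
    { isPermAction  = pow-isPermAction
    ; ⇐-cong        = λ u a p≈q x → p≈q (x X.[ a ≔ u ])
    ; ⇐-equivariant = λ π p u a y → ≡⇒∈⇔ p (subst-under-inverse π u a y)
    ; amgis         = λ p u v a b a≢b a#v x → ≡⇒∈⇔ p (X.σ-σ a b x u v a≢b a#v)
    }

  -- Exactness: an atom c fresh for x and outside the exception list L
  -- satisfies x[c:=u] = x, so p and q agree at x.
  pow-isExact : IsExact U (_≈Pow_ X) (_[_⇐Pow_] X)
  pow-isExact p q u (L , p⇐c≈q⇐c) x
    with X.finitelySupported x
  ... | A , A-supports-x
    with fresh (A ++ L)
  ... | c , c∉A++L =
    (λ x∈p → subst q x[c≔u]≡x (proj₁ agree (subst p (sym x[c≔u]≡x) x∈p)))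
    , (λ x∈q → subst p x[c≔u]≡x (proj₂ agree (subst q (sym x[c≔u]≡x) x∈q)))
    where
    c#x : c X.# x
    c#x = A , A-supports-x , (λ c∈A → c∉A++L (∈-++⁺ˡ c∈A))

    x[c≔u]≡x : x X.[ c ≔ u ] ≡ x
    x[c≔u]≡x = X.σ-# c x u c#x

    agree : (p (x X.[ c ≔ u ]) → q (x X.[ c ≔ u ])) × (q (x X.[ c ≔ u ]) → p (x X.[ c ≔ u ]))
    agree = p⇐c≈q⇐c c (λ c∈L → c∉A++L (∈-++⁺ʳ A c∈L)) x

proposition3p22 : (U : TermlikeSigma) (X : SigmaAlg U) →
    IsAmgisAlg U (_≈Pow_ X) (_·Pow_ X) (_[_⇐Pow_] X) × IsExact U (_≈Pow_ X) (_[_⇐Pow_] X)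
proposition3p22 U X = pow-isAmgisAlg X , pow-isExact X
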